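{- Let $m,k,i$ be positive integers with $i<2^m-1$, and let $\delta\in\mathbb{F}_{2^{2m}}$. Then the polynomial $f(x)=x+\left(\mathrm{Tr}_m^{2m}(x)^k+\delta\right)^{i(2^m+1)}$ is an involution over $\mathbb{F}_{2^{2m}}$, i.e. $f(f(x))=x$ for all $x\in\mathbb{F}_{2^{2m}}$.
   Context: $\mathrm{Tr}_m^{2m}(x)=x+x^{2^m}$ is the trace map from $\mathbb{F}_{2^{2m}}$ to $\mathbb{F}_{2^m}$. -}

module Defs where

open import Level using (Level; _⊔_)
open import Data.Nat using (ℕ)
import Data.Nat as ℕ
open import Data.Fin using (Fin)
open import Data.Product using (Σ; ∃)
open import Relation.Binary.PropositionalEquality using (_≡_)
open import Relation.Nullary using (¬_)
open import Algebra.Bundles using (CommutativeRing; Semiring)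

record IsFieldCR {c ℓ : Level} (R : CommutativeRing c ℓ) : Set (c ⊔ ℓ) where
  open CommutativeRing R
  field
    0≉1 : ¬ (0# ≈ 1#)
    inverse : ∀ x → ¬ (x ≈ 0#) → Σ Carrier (λ y → (x * y) ≈ 1#)

record HasCardinality {c ℓ : Level} (R : CommutativeRing c ℓ) (n : ℕ) : Set (c ⊔ ℓ) where
  open CommutativeRing R
  field
    enc : Fin n → Carrier
    enc-injective : ∀ i j → enc i ≈ enc j → i ≡ j
    enc-surjective : ∀ x → ∃ (λ i → enc i ≈ x)

-- A model of F_{q}: a field with exactly q elements (unique up to isomorphism).
record IsFiniteFieldOfOrder {c ℓ : Level} (R : CommutativeRing c ℓ) (q : ℕ) : Set (c ⊔ ℓ) where
  field
    isField : IsFieldCR R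
    card : HasCardinality R q

module _ {c ℓ : Level} (R : CommutativeRing c ℓ) where
  open CommutativeRing R
  open import Algebra.Definitions.RawSemiring (Semiring.rawSemiring semiring) using () renaming (_^_ to _^ᴿ_)

  Tr : ℕ → Carrier → Carrier
  Tr m x = x + (x ^ᴿ (2 ℕ.^ m))

  involutionCandidate : ℕ → ℕ → ℕ → Carrier → Carrier → Carrier
  involutionCandidate m k i δ x = x + (((Tr m x ^ᴿ k) + δ) ^ᴿ (i ℕ.* (2 ℕ.^ m ℕ.+ 1)))

{-# OPTIONS --safe #-}
-- Put q = 2 ^ m and y = (Tr x ^ k + δ) ^ (i (q + 1)), so that f x = x + y. Since z ^ q² ≈ z for every z,
-- the norm z ^ (q + 1) is fixed by z ↦ z ^ q, hence so is y. In characteristic 2 the map z ↦ z ^ q is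
-- additive, so Tr (x + y) ≈ Tr x + y + y ^ q ≈ Tr x, and therefore f (f x) ≈ x + y + y ≈ x.
-- Both facts about the field, z ^ q² ≈ z and 1 + 1 ≈ 0, follow from its cardinality alone, by
-- reindexing products and sums along the permutations z ↦ a z (a ≉ 0) and z ↦ 1 + z.
module Submission where

open import Defs
open import Level using (Level)
open import Algebra.Bundles using (CommutativeRing; CommutativeSemiring; Semiring)
open import Data.Empty using (⊥-elim)
open import Data.Fin as Fin using (Fin; punchIn)
open import Data.Fin.Permutation using (Permutation; permutation; remove; _⟨$⟩ʳ_; punchIn-permute)
import Data.Fin.Properties as Finₚ
open import Data.Nat as ℕ using (ℕ; zero; suc)
import Data.Nat.Properties as ℕ
open import Data.Product using (proj₁; proj₂; _,_)
open import Data.Vec.Functional using (replicate)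
open import Relation.Binary.Definitions using (Decidable)
open import Relation.Binary.PropositionalEquality as ≡ using (_≡_)
open import Relation.Nullary using (¬_; Dec; yes; no)
open import Relation.Nullary.Decidable using (map′)

private
  variable
    c ℓ : Level

2^[2m]≡2^m*2^m : ∀ m → 2 ℕ.^ (2 ℕ.* m) ≡ 2 ℕ.^ m ℕ.* 2 ℕ.^ m
2^[2m]≡2^m*2^m m =
  ≡.trans (ℕ.^-distribˡ-+-* 2 m (m ℕ.+ 0)) (≡.cong (λ e → 2 ℕ.^ m ℕ.* 2 ℕ.^ e) (ℕ.+-identityʳ m))

module _ (S : Semiring c ℓ) where
  open Semiring S
  open import Algebra.Properties.Semiring.Exp S
  open import Algebra.Properties.Semiring.Mult S
  open import Relation.Binary.Reasoning.Setoid setoid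

  ×1-homo-^ : ∀ b e → (b ℕ.^ e) × 1# ≈ (b × 1#) ^ e
  ×1-homo-^ b zero    = +-identityʳ 1#
  ×1-homo-^ b (suc e) = begin
    (b ℕ.* b ℕ.^ e) × 1#          ≈⟨ ×1-homo-* b (b ℕ.^ e) ⟩
    (b × 1#) * ((b ℕ.^ e) × 1#)   ≈⟨ *-congˡ (×1-homo-^ b e) ⟩
    (b × 1#) * (b × 1#) ^ e       ∎

module _ (S : CommutativeSemiring c ℓ) where
  open CommutativeSemiring S
  open import Algebra.Properties.Semiring.Exp semiring
  open import Relation.Binary.Reasoning.Setoid setoid

  z^[q+1]^q≈z^[q+1] : ∀ q → (∀ z → z ^ (q ℕ.* q) ≈ z) → ∀ z → (z ^ (q ℕ.+ 1)) ^ q ≈ z ^ (q ℕ.+ 1)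
  z^[q+1]^q≈z^[q+1] q z^q²≈z z = begin
    (z ^ (q ℕ.+ 1)) ^ q       ≈⟨ ^-assocʳ z (q ℕ.+ 1) q ⟩
    z ^ ((q ℕ.+ 1) ℕ.* q)     ≡⟨ ≡.cong (z ^_) [q+1]q≡q²+q ⟩
    z ^ (q ℕ.* q ℕ.+ q)       ≈⟨ ^-homo-* z (q ℕ.* q) q ⟩
    z ^ (q ℕ.* q) * z ^ q     ≈⟨ *-congʳ (z^q²≈z z) ⟩
    z ^ suc q                 ≡⟨ ≡.cong (z ^_) (ℕ.+-comm 1 q) ⟩
    z ^ (q ℕ.+ 1)             ∎
    where
    [q+1]q≡q²+q : (q ℕ.+ 1) ℕ.* q ≡ q ℕ.* q ℕ.+ q
    [q+1]q≡q²+q = ≡.trans (ℕ.*-distribʳ-+ q q 1) (≡.cong (q ℕ.* q ℕ.+_) (ℕ.*-identityˡ q))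

  z^[i[q+1]]^q≈z^[i[q+1]] : ∀ q → (∀ z → z ^ (q ℕ.* q) ≈ z) →
                            ∀ i z → (z ^ (i ℕ.* (q ℕ.+ 1))) ^ q ≈ z ^ (i ℕ.* (q ℕ.+ 1))
  z^[i[q+1]]^q≈z^[i[q+1]] q z^q²≈z i z = begin
    (z ^ (i ℕ.* (q ℕ.+ 1))) ^ q  ≈⟨ ^-congˡ q z^[i[q+1]]≈w^i ⟩
    (w ^ i) ^ q                  ≈⟨ ^-assocʳ w i q ⟩
    w ^ (i ℕ.* q)                ≡⟨ ≡.cong (w ^_) (ℕ.*-comm i q) ⟩
    w ^ (q ℕ.* i)                ≈⟨ ^-assocʳ w q i ⟨
    (w ^ q) ^ i                  ≈⟨ ^-congˡ i (z^[q+1]^q≈z^[q+1] q z^q²≈z z) ⟩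
    w ^ i                        ≈⟨ z^[i[q+1]]≈w^i ⟨
    z ^ (i ℕ.* (q ℕ.+ 1))        ∎
    where
    w : Carrier
    w = z ^ (q ℕ.+ 1)
    z^[i[q+1]]≈w^i : z ^ (i ℕ.* (q ℕ.+ 1)) ≈ w ^ i
    z^[i[q+1]]≈w^i = begin
      z ^ (i ℕ.* (q ℕ.+ 1))  ≡⟨ ≡.cong (z ^_) (ℕ.*-comm i (q ℕ.+ 1)) ⟩
      z ^ ((q ℕ.+ 1) ℕ.* i)  ≈⟨ ^-assocʳ z (q ℕ.+ 1) i ⟨
      w ^ i                  ∎

module Finite {R : CommutativeRing c ℓ} {n : ℕ} (card : HasCardinality R n) where
  open CommutativeRing R
  open HasCardinality card
  open import Algebra.Properties.Ring ring using (+-identityˡ-unique; \\-leftDividesˡ; \\-leftDividesʳ)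
  open import Algebra.Properties.CommutativeMonoid.Sum +-commutativeMonoid
    using (sum; ∑-permute; sum-cong-≋; ∑-distrib-+; sum-replicate)
  open import Algebra.Properties.Semiring.Mult semiring using (_×_)
  open import Relation.Binary.Reasoning.Setoid setoid

  decode : Carrier → Fin n
  decode x = proj₁ (enc-surjective x)

  enc-decode : ∀ x → enc (decode x) ≈ x
  enc-decode x = proj₂ (enc-surjective x)

  decode-cong : ∀ {x y} → x ≈ y → decode x ≡ decode y
  decode-cong {x} {y} x≈y = enc-injective _ _ (trans (enc-decode x) (trans x≈y (sym (enc-decode y))))

  _≟_ : Decidable _≈_
  x ≟ y = map′ decode-injective decode-cong (decode x Finₚ.≟ decode y)
    where
    decode-injective : decode x ≡ decode y → x ≈ y
    decode-injective eq = trans (sym (enc-decode x)) (trans (reflexive (≡.cong enc eq)) (enc-decode y))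

  toPermutation : (h h⁻¹ : Carrier → Carrier) →
                  (∀ {x y} → x ≈ y → h x ≈ h y) → (∀ {x y} → x ≈ y → h⁻¹ x ≈ h⁻¹ y) →
                  (∀ x → h (h⁻¹ x) ≈ x) → (∀ x → h⁻¹ (h x) ≈ x) → Permutation n n
  toPermutation h h⁻¹ h-cong h⁻¹-cong inverseˡ inverseʳ =
    permutation (λ j → decode (h (enc j))) (λ j → decode (h⁻¹ (enc j)))
      (λ j → enc-injective _ _ (trans (enc-decode _) (trans (h-cong (enc-decode _)) (inverseˡ (enc j)))))
      (λ j → enc-injective _ _ (trans (enc-decode _) (trans (h⁻¹-cong (enc-decode _)) (inverseʳ (enc j)))))

  n×1≈0 : n × 1# ≈ 0#
  n×1≈0 = +-identityˡ-unique (n × 1#) (sum enc) (sym (begin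
    sum enc                          ≈⟨ ∑-permute enc shift ⟩
    sum (λ j → enc (shift ⟨$⟩ʳ j))   ≈⟨ sum-cong-≋ {n} (λ j → enc-decode (1# + enc j)) ⟩
    sum (λ j → 1# + enc j)           ≈⟨ ∑-distrib-+ (replicate n 1#) enc ⟩
    sum (replicate n 1#) + sum enc   ≈⟨ +-congʳ (sum-replicate n) ⟩
    n × 1# + sum enc                 ∎))
    where
    shift : Permutation n n
    shift = toPermutation (1# +_) (- 1# +_) +-congˡ +-congˡ (\\-leftDividesˡ 1#) (\\-leftDividesʳ 1#)

module Field {R : CommutativeRing c ℓ} (isField : IsFieldCR R) where
  open CommutativeRing R
  open IsFieldCR isField
  open import Algebra.Properties.CommutativeMonoid.Sum *-commutativeMonoid using () renaming (sum to ∏)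
  open import Relation.Binary.Reasoning.Setoid setoid

  1≉0 : ¬ 1# ≈ 0#
  1≉0 1≈0 = 0≉1 (sym 1≈0)

  x≉0∧x*y≈0⇒y≈0 : ∀ {x y} → ¬ x ≈ 0# → x * y ≈ 0# → y ≈ 0#
  x≉0∧x*y≈0⇒y≈0 {x} {y} x≉0 x*y≈0 with inverse x x≉0
  ... | u , x*u≈1 = begin
    y            ≈⟨ *-identityˡ y ⟨
    1# * y       ≈⟨ *-congʳ (trans (*-comm u x) x*u≈1) ⟨
    (u * x) * y  ≈⟨ *-assoc u x y ⟩
    u * (x * y)  ≈⟨ *-congˡ x*y≈0 ⟩
    u * 0#       ≈⟨ zeroʳ u ⟩
    0#           ∎

  y≉0∧x*y≈y⇒x≈1 : ∀ {x y} → ¬ y ≈ 0# → x * y ≈ y → x ≈ 1#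
  y≉0∧x*y≈y⇒x≈1 {x} {y} y≉0 x*y≈y with inverse y y≉0
  ... | v , y*v≈1 = begin
    x            ≈⟨ *-identityʳ x ⟨
    x * 1#       ≈⟨ *-congˡ y*v≈1 ⟨
    x * (y * v)  ≈⟨ *-assoc x y v ⟨
    (x * y) * v  ≈⟨ *-congʳ x*y≈y ⟩
    y * v        ≈⟨ y*v≈1 ⟩
    1#           ∎

  ∏≉0 : ∀ {k} (f : Fin k → Carrier) → (∀ j → ¬ f j ≈ 0#) → ¬ ∏ f ≈ 0#
  ∏≉0 {zero}  f f≉0 = 1≉0
  ∏≉0 {suc k} f f≉0 ∏f≈0 =
    ∏≉0 (λ j → f (Fin.suc j)) (λ j → f≉0 (Fin.suc j)) (x≉0∧x*y≈0⇒y≈0 (f≉0 Fin.zero) ∏f≈0)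

module FiniteField {R : CommutativeRing c ℓ} {n : ℕ} (FF : IsFiniteFieldOfOrder R n) where
  open CommutativeRing R
  open IsFiniteFieldOfOrder FF
  open IsFieldCR isField
  open HasCardinality card
  open Finite card
  open Field isField
  open import Algebra.Properties.Semiring.Exp semiring
  open import Algebra.Properties.CommutativeMonoid.Sum *-commutativeMonoid
    using (∑-permute; sum-cong-≋; ∑-distrib-+; sum-replicate) renaming (sum to ∏)
  open import Relation.Binary.Reasoning.Setoid setoid

  x^e≈0⇒x≈0 : ∀ e {x} → x ^ e ≈ 0# → x ≈ 0#
  x^e≈0⇒x≈0 zero        1≈0         = ⊥-elim (1≉0 1≈0)
  x^e≈0⇒x≈0 (suc e) {x} x^[1+e]≈0 with x ≟ 0#
  ... | yes x≈0 = x≈0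
  ... | no  x≉0 = x^e≈0⇒x≈0 e (x≉0∧x*y≈0⇒y≈0 x≉0 x^[1+e]≈0)

  -- Multiplication by a fixes 0, so it permutes the nonzero elements u j: a ^ (n - 1) * ∏ u ≈ ∏ u.
  x≉0⇒x^[n-1]≈1 : ∀ {n′} → n ≡ suc n′ → ∀ {a} → ¬ a ≈ 0# → a ^ n′ ≈ 1#
  x≉0⇒x^[n-1]≈1 {n′} ≡.refl {a} a≉0 = y≉0∧x*y≈y⇒x≈1 (∏≉0 u u≉0) (sym (begin
    ∏ u                       ≈⟨ ∑-permute u σ ⟩
    ∏ (λ j → u (σ ⟨$⟩ʳ j))    ≈⟨ sum-cong-≋ {n′} u∘σ≈a*u ⟩
    ∏ (λ j → a * u j)         ≈⟨ ∑-distrib-+ (replicate n′ a) u ⟩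
    ∏ (replicate n′ a) * ∏ u  ≈⟨ *-congʳ (sum-replicate n′) ⟩
    a ^ n′ * ∏ u              ∎))
    where
    o : Fin n
    o = decode 0#
    u : Fin n′ → Carrier
    u j = enc (punchIn o j)
    u≉0 : ∀ j → ¬ u j ≈ 0#
    u≉0 j uj≈0 = Finₚ.punchInᵢ≢i o j (enc-injective _ _ (trans uj≈0 (sym (enc-decode 0#))))
    b : Carrier
    b = proj₁ (inverse a a≉0)
    a*b≈1 : a * b ≈ 1#
    a*b≈1 = proj₂ (inverse a a≉0)
    scale : Permutation n n
    scale = toPermutation (a *_) (b *_) *-congˡ *-congˡ
      (λ x → trans (sym (*-assoc a b x)) (trans (*-congʳ a*b≈1) (*-identityˡ x)))
      (λ x → trans (sym (*-assoc b a x)) (trans (*-congʳ (trans (*-comm b a) a*b≈1)) (*-identityˡ x)))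
    scale-fixes-o : scale ⟨$⟩ʳ o ≡ o
    scale-fixes-o = decode-cong (trans (*-congˡ (enc-decode 0#)) (zeroʳ a))
    σ : Permutation n′ n′
    σ = remove o scale
    u∘σ≈a*u : ∀ j → u (σ ⟨$⟩ʳ j) ≈ a * u j
    u∘σ≈a*u j = begin
      enc (punchIn o (σ ⟨$⟩ʳ j))               ≡⟨ ≡.cong (λ p → enc (punchIn p (σ ⟨$⟩ʳ j))) scale-fixes-o ⟨
      enc (punchIn (scale ⟨$⟩ʳ o) (σ ⟨$⟩ʳ j))  ≡⟨ ≡.cong enc (punchIn-permute scale o j) ⟨
      enc (scale ⟨$⟩ʳ punchIn o j)             ≈⟨ enc-decode (a * u j) ⟩
      a * u j                                  ∎

  n≡suc[pred[n]] : n ≡ suc (ℕ.pred n)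
  n≡suc[pred[n]] = ≡.sym (ℕ.suc-pred n {{Finₚ.nonZeroIndex (decode 0#)}})

  x^n≈x : ∀ a → a ^ n ≈ a
  x^n≈x a = trans (^-congʳ a n≡suc[pred[n]]) (a*a^pred[n]≈a (a ≟ 0#))
    where
    a*a^pred[n]≈a : Dec (a ≈ 0#) → a * a ^ ℕ.pred n ≈ a
    a*a^pred[n]≈a (yes a≈0) = trans (*-congʳ a≈0) (trans (zeroˡ _) (sym a≈0))
    a*a^pred[n]≈a (no a≉0)  = trans (*-congˡ (x≉0⇒x^[n-1]≈1 n≡suc[pred[n]] a≉0)) (*-identityʳ a)

HasCharacteristicTwo : CommutativeRing c ℓ → Set ℓ
HasCharacteristicTwo R = 1# + 1# ≈ 0#
  where open CommutativeRing R

module _ {R : CommutativeRing c ℓ} (e : ℕ) (FF : IsFiniteFieldOfOrder R (2 ℕ.^ e)) where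
  open CommutativeRing R
  open IsFiniteFieldOfOrder FF
  open Finite card using (n×1≈0)
  open FiniteField FF using (x^e≈0⇒x≈0)
  open import Algebra.Properties.Semiring.Mult semiring using (_×_)
  open import Relation.Binary.Reasoning.Setoid setoid

  characteristic-two : HasCharacteristicTwo R
  characteristic-two = begin
    1# + 1#  ≈⟨ +-congˡ (+-identityʳ 1#) ⟨
    2 × 1#   ≈⟨ x^e≈0⇒x≈0 e (trans (sym (×1-homo-^ semiring 2 e)) n×1≈0) ⟩
    0#       ∎

module CharacteristicTwo (R : CommutativeRing c ℓ) (1+1≈0 : HasCharacteristicTwo R) where
  open CommutativeRing R
  open import Algebra.Properties.Semiring.Exp semiring
  open import Algebra.Solver.Ring.NaturalCoefficients.Default commutativeSemiring
  open import Relation.Binary.Reasoning.Setoid setoid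

  x+x≈0 : ∀ x → x + x ≈ 0#
  x+x≈0 x = begin
    x + x            ≈⟨ +-cong (*-identityˡ x) (*-identityˡ x) ⟨
    1# * x + 1# * x  ≈⟨ distribʳ x 1# 1# ⟨
    (1# + 1#) * x    ≈⟨ *-congʳ 1+1≈0 ⟩
    0# * x           ≈⟨ zeroˡ x ⟩
    0#               ∎

  x+y+y≈x : ∀ x y → x + y + y ≈ x
  x+y+y≈x x y = trans (+-assoc x y y) (trans (+-congˡ (x+x≈0 y)) (+-identityʳ x))

  ^2-distrib-+ : ∀ a b → (a + b) ^ 2 ≈ a ^ 2 + b ^ 2
  ^2-distrib-+ a b = begin
    (a + b) ^ 2                        ≈⟨ solve 2 (λ a b → (a :+ b) :^ 2 := (a :^ 2 :+ b :^ 2) :+ (a :* b :+ a :* b)) refl a b ⟩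
    (a ^ 2 + b ^ 2) + (a * b + a * b)  ≈⟨ +-congˡ (x+x≈0 (a * b)) ⟩
    (a ^ 2 + b ^ 2) + 0#               ≈⟨ +-identityʳ _ ⟩
    a ^ 2 + b ^ 2                      ∎

  ^2^e-distrib-+ : ∀ e a b → (a + b) ^ (2 ℕ.^ e) ≈ a ^ (2 ℕ.^ e) + b ^ (2 ℕ.^ e)
  ^2^e-distrib-+ zero    a b = trans (*-identityʳ (a + b)) (sym (+-cong (*-identityʳ a) (*-identityʳ b)))
  ^2^e-distrib-+ (suc e) a b = begin
    (a + b) ^ (2 ℕ.* 2 ℕ.^ e)                  ≈⟨ ^-assocʳ (a + b) 2 (2 ℕ.^ e) ⟨
    ((a + b) ^ 2) ^ (2 ℕ.^ e)                  ≈⟨ ^-congˡ (2 ℕ.^ e) (^2-distrib-+ a b) ⟩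
    (a ^ 2 + b ^ 2) ^ (2 ℕ.^ e)                ≈⟨ ^2^e-distrib-+ e (a ^ 2) (b ^ 2) ⟩
    (a ^ 2) ^ (2 ℕ.^ e) + (b ^ 2) ^ (2 ℕ.^ e)  ≈⟨ +-cong (^-assocʳ a 2 (2 ℕ.^ e)) (^-assocʳ b 2 (2 ℕ.^ e)) ⟩
    a ^ (2 ℕ.* 2 ℕ.^ e) + b ^ (2 ℕ.* 2 ℕ.^ e)  ∎

  Tr[x+y]≈Tr[x] : ∀ m {x y} → y ^ (2 ℕ.^ m) ≈ y → Tr R m (x + y) ≈ Tr R m x
  Tr[x+y]≈Tr[x] m {x} {y} y^q≈y = begin
    (x + y) + (x + y) ^ q      ≈⟨ +-congˡ (^2^e-distrib-+ m x y) ⟩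
    (x + y) + (x ^ q + y ^ q)  ≈⟨ +-congˡ (+-congˡ y^q≈y) ⟩
    (x + y) + (x ^ q + y)      ≈⟨ +-assoc (x + y) (x ^ q) y ⟨
    (x + y) + x ^ q + y        ≈⟨ +-congʳ (+-assoc x y (x ^ q)) ⟩
    x + (y + x ^ q) + y        ≈⟨ +-congʳ (+-congˡ (+-comm y (x ^ q))) ⟩
    x + (x ^ q + y) + y        ≈⟨ +-congʳ (+-assoc x (x ^ q) y) ⟨
    x + x ^ q + y + y          ≈⟨ x+y+y≈x (x + x ^ q) y ⟩
    x + x ^ q                  ∎
    where
    q : ℕ
    q = 2 ℕ.^ m

  involutionCandidate-involutive : ∀ m → (∀ z → z ^ (2 ℕ.^ (2 ℕ.* m)) ≈ z) →
    ∀ k i δ x → involutionCandidate R m k i δ (involutionCandidate R m k i δ x) ≈ x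
  involutionCandidate-involutive m z^[2^[2m]]≈z k i δ x = begin
    (x + y) + g (x + y)  ≈⟨ +-congˡ g[x+y]≈y ⟩
    (x + y) + y          ≈⟨ x+y+y≈x x y ⟩
    x                    ∎
    where
    q : ℕ
    q = 2 ℕ.^ m
    g : Carrier → Carrier
    g u = (Tr R m u ^ k + δ) ^ (i ℕ.* (q ℕ.+ 1))
    y : Carrier
    y = g x
    z^q²≈z : ∀ z → z ^ (q ℕ.* q) ≈ z
    z^q²≈z z = trans (^-congʳ z (≡.sym (2^[2m]≡2^m*2^m m))) (z^[2^[2m]]≈z z)
    y^q≈y : y ^ q ≈ y
    y^q≈y = z^[i[q+1]]^q≈z^[i[q+1]] commutativeSemiring q z^q²≈z i (Tr R m x ^ k + δ)
    g[x+y]≈y : g (x + y) ≈ y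
    g[x+y]≈y = ^-congˡ (i ℕ.* (q ℕ.+ 1)) (+-congʳ (^-congˡ k (Tr[x+y]≈Tr[x] m y^q≈y)))

open import Data.Nat using (_^_; _<_; _∸_; _*_; NonZero)

theorem11 : {c ℓ : Level} (F : CommutativeRing c ℓ) (m k i : ℕ)
    → .{{_ : NonZero m}} → .{{_ : NonZero k}} → .{{_ : NonZero i}}
    → i < 2 ^ m ∸ 1
    → IsFiniteFieldOfOrder F (2 ^ (2 * m))
    → (δ x : CommutativeRing.Carrier F)
    → CommutativeRing._≈_ F
    (involutionCandidate F m k i δ (involutionCandidate F m k i δ x)) x
theorem11 F m k i _ FF = CharacteristicTwo.involutionCandidate-involutive
  F (characteristic-two (2 * m) FF) m (FiniteField.x^n≈x FF) k i
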